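{- The following is provable in $\mathsf{RCA}_0$. Let $\leq_H$ denote the quasi order on $H_f(1\oplus 2)$. Then for all $m,n\in\mathbb N$, \[ \dot m\leq_H\dot n\iff \ddot m\leq_H\ddot n\iff \dot m\leq_H\ddot n\iff m\leq n, \] and moreover $\ddot m\not\leq_H\dot n$ for all $m,n\in\mathbb N$.
   Context: $1\oplus 2$ is the partial order on the set $\{\star,0,1\}$ whose only strict inequality is $0<1$. For a quasi order $Q$, the set $H_f(Q)$ is generated recursively: each $q\in Q$ is an element of $H_f(Q)$, and each finite set $a$ of already constructed elements of $H_f(Q)$ is an element of $H_f(Q)$ (elements of $Q$ and finite sets are kept formally distinct; in $\mathsf{RCA}_0$ elements are coded as finite labelled trees). The quasi order $\leq_H$ on $H_f(Q)$ is defined recursively by: for $p,q\in Q$, $p\leq_H q$ iff $p\leq_Q q$; for $p\in Q$ and a set $b$, $p\leq_H b$ iff some $y\in b$ has $p\leq_H y$; for a set $a$ and $q\in Q$, $a\leq_H q$ iff all $x\in a$ satisfy $x\leq_H q$; for sets $a,b$, $a\leq_H b$ iff every $x\in a$ admits $y\in b$ with $x\leq_H y$. For $n\in\mathbb N$, the elements $\dot n,\ddot n\in H_f(1\oplus 2)$ are defined recursively by $\dot n=\{\star,0\}\cup\{\dot m\mid m<n\}$ and $\ddot n=\{\star,1\}\cup\{\ddot m\mid m<n\}$. -}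

module Defs where

open import Data.Nat using (ℕ; zero; suc)
open import Data.List using (List; []; _∷_; _++_)
open import Data.Empty using (⊥)
open import Data.Unit using (⊤)
open import Data.Product using (_×_)
open import Data.Sum using (_⊎_)

-- The partial order 1 ⊕ 2 on {⋆, 0, 1}: only strict inequality is 0 < 1.
data P : Set where
  ⋆ 𝟘 𝟙 : P

_≤P_ : P → P → Set
⋆ ≤P ⋆ = ⊤
𝟘 ≤P 𝟘 = ⊤
𝟘 ≤P 𝟙 = ⊤
𝟙 ≤P 𝟙 = ⊤
_ ≤P _ = ⊥

-- Hereditarily finite sets with urelements from P.  A finite set is
-- represented by a finite list of its elements (the relation ≤H below
-- is insensitive to order and repetitions, so this is harmless).
data HF : Set where
  atom : P → HF
  set  : List HF → HF

mutual
  _≤H_ : HF → HF → Set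
  atom p ≤H atom q = p ≤P q
  atom p ≤H set b  = AnyBelow (atom p) b
  set a  ≤H atom q = AllBelowAtom a q
  set a  ≤H set b  = AllInSet a b

  AnyBelow : HF → List HF → Set
  AnyBelow x []       = ⊥
  AnyBelow x (y ∷ ys) = (x ≤H y) ⊎ AnyBelow x ys

  AllBelowAtom : List HF → P → Set
  AllBelowAtom []       q = ⊤
  AllBelowAtom (x ∷ xs) q = (x ≤H atom q) × AllBelowAtom xs q

  AllInSet : List HF → List HF → Set
  AllInSet []       b = ⊤
  AllInSet (x ∷ xs) b = AnyBelow x b × AllInSet xs b

mutual
  dot : ℕ → HF
  dot n = set (atom ⋆ ∷ atom 𝟘 ∷ dots n)

  dots : ℕ → List HF
  dots zero    = []
  dots (suc n) = dot n ∷ dots n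

mutual
  ddot : ℕ → HF
  ddot n = set (atom ⋆ ∷ atom 𝟙 ∷ ddots n)

  ddots : ℕ → List HF
  ddots zero    = []
  ddots (suc n) = ddot n ∷ ddots n

{-# OPTIONS --safe #-}
module Submission where

open import Defs
open import Data.Nat using (ℕ; _≤_; _<_; zero; suc; z≤n; s≤s; s≤s⁻¹)
open import Data.Nat.Properties using (≤-refl; ≤-trans; n≤1+n; m≤n⇒m≤1+n; m≤n⇒m<n∨m≡n)
open import Data.Product using (_×_; _,_; ∃-syntax)
open import Data.Sum using (inj₁; inj₂)
open import Data.Unit using (tt)
open import Data.Empty using (⊥-elim)
open import Data.List using (List; []; _∷_)
open import Function.Base using (id)
open import Function.Bundles using (_⇔_; mk⇔)
open import Function.Properties.Equivalence using () renaming (trans to ⇔-trans; sym to ⇔-sym)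
open import Relation.Nullary using (¬_)
open import Relation.Binary.PropositionalEquality using (_≡_; refl; cong; cong₂; subst)

-- Proof idea: ṅ and n̈ are instances of the tower t_a(n) = {⋆, a} ∪ {t_a(m) | m < n}.
-- If a ≤ c, a ≰ ⋆ and ⋆ ≰ c, then t_a(m) ≤_H t_c(n) iff m ≤ n: the atoms ⋆ and a
-- are matched by ⋆ and c, while t_a(m) contains the atoms ⋆ and a, so it lies below
-- neither atom of t_c(n) and must lie below some t_c(j) with j < n.  Finally
-- m̈ ≰_H ṅ because the atom 1 lies below no element of ṅ.

mutual
  tower : P → ℕ → HF
  tower a n = set (atom ⋆ ∷ atom a ∷ towers a n)

  towers : P → ℕ → List HF
  towers a zero    = []
  towers a (suc n) = tower a n ∷ towers a n

mutual
  dot≡tower : ∀ n → dot n ≡ tower 𝟘 n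
  dot≡tower n = cong (λ l → set (atom ⋆ ∷ atom 𝟘 ∷ l)) (dots≡towers n)

  dots≡towers : ∀ n → dots n ≡ towers 𝟘 n
  dots≡towers zero    = refl
  dots≡towers (suc n) = cong₂ _∷_ (dot≡tower n) (dots≡towers n)

mutual
  ddot≡tower : ∀ n → ddot n ≡ tower 𝟙 n
  ddot≡tower n = cong (λ l → set (atom ⋆ ∷ atom 𝟙 ∷ l)) (ddots≡towers n)

  ddots≡towers : ∀ n → ddots n ≡ towers 𝟙 n
  ddots≡towers zero    = refl
  ddots≡towers (suc n) = cong₂ _∷_ (ddot≡tower n) (ddots≡towers n)

≤H-⇔-resp-≡ : ∀ {x x′ y y′} {Q : Set} → x ≡ x′ → y ≡ y′ → (x′ ≤H y′) ⇔ Q → (x ≤H y) ⇔ Q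
≤H-⇔-resp-≡ refl refl = id

module _ {c : P} where

  anyBelow-towers⁺ : ∀ {x k} n → k < n → x ≤H tower c k → AnyBelow x (towers c n)
  anyBelow-towers⁺ (suc n) k<1+n x≤t with m≤n⇒m<n∨m≡n (s≤s⁻¹ k<1+n)
  ... | inj₁ k<n  = inj₂ (anyBelow-towers⁺ n k<n x≤t)
  ... | inj₂ refl = inj₁ x≤t

  anyBelow-towers⁻ : ∀ {x} n → AnyBelow x (towers c n) → ∃[ j ] j < n × x ≤H tower c j
  anyBelow-towers⁻ (suc n) (inj₁ x≤t) = n , ≤-refl , x≤t
  anyBelow-towers⁻ (suc n) (inj₂ x∈) with anyBelow-towers⁻ n x∈
  ... | j , j<n , x≤t = j , m≤n⇒m≤1+n j<n , x≤t

module _ {a c : P} (a≤c : a ≤P c) where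

  mutual
    ≤⇒tower-≤H-tower : ∀ {m n} → m ≤ n → tower a m ≤H tower c n
    ≤⇒tower-≤H-tower m≤n = inj₁ tt , inj₂ (inj₁ a≤c) , towers-allInSet m≤n

    towers-allInSet : ∀ {m n} → m ≤ n → AllInSet (towers a m) (atom ⋆ ∷ atom c ∷ towers c n)
    towers-allInSet {zero}  _      = tt
    towers-allInSet {suc m} {n} m<n =
      inj₂ (inj₂ (anyBelow-towers⁺ n m<n (≤⇒tower-≤H-tower ≤-refl))) ,
      towers-allInSet (≤-trans (n≤1+n m) m<n)

  tower-≤H-tower⇒≤ : ¬ a ≤P ⋆ → ¬ ⋆ ≤P c → ∀ m n → tower a m ≤H tower c n → m ≤ n
  tower-≤H-tower⇒≤ a≰⋆ ⋆≰c zero    n _ = z≤n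
  tower-≤H-tower⇒≤ a≰⋆ ⋆≰c (suc m) n (_ , _ , t≤ , _) with t≤
  ... | inj₁ (_ , a≤⋆ , _)    = ⊥-elim (a≰⋆ a≤⋆)
  ... | inj₂ (inj₁ (⋆≤c , _)) = ⊥-elim (⋆≰c ⋆≤c)
  ... | inj₂ (inj₂ t∈) with anyBelow-towers⁻ n t∈
  ...   | j , j<n , t≤t = ≤-trans (s≤s (tower-≤H-tower⇒≤ a≰⋆ ⋆≰c m j t≤t)) j<n

  tower-≤H-tower⇔≤ : ¬ a ≤P ⋆ → ¬ ⋆ ≤P c → ∀ m n → (tower a m ≤H tower c n) ⇔ (m ≤ n)
  tower-≤H-tower⇔≤ a≰⋆ ⋆≰c m n = mk⇔ (tower-≤H-tower⇒≤ a≰⋆ ⋆≰c m n) ≤⇒tower-≤H-tower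

mutual
  atom-≰H-tower : ∀ {p a} → ¬ p ≤P ⋆ → ¬ p ≤P a → ∀ n → ¬ atom p ≤H tower a n
  atom-≰H-tower p≰⋆ p≰a n (inj₁ p≤⋆)        = p≰⋆ p≤⋆
  atom-≰H-tower p≰⋆ p≰a n (inj₂ (inj₁ p≤a)) = p≰a p≤a
  atom-≰H-tower p≰⋆ p≰a n (inj₂ (inj₂ p∈))  = atom-≰H-towers p≰⋆ p≰a n p∈

  atom-≰H-towers : ∀ {p a} → ¬ p ≤P ⋆ → ¬ p ≤P a → ∀ n → ¬ AnyBelow (atom p) (towers a n)
  atom-≰H-towers p≰⋆ p≰a (suc n) (inj₁ p≤t) = atom-≰H-tower p≰⋆ p≰a n p≤t
  atom-≰H-towers p≰⋆ p≰a (suc n) (inj₂ p∈)  = atom-≰H-towers p≰⋆ p≰a n p∈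

dot-≤H-dot⇔≤ : ∀ m n → (dot m ≤H dot n) ⇔ (m ≤ n)
dot-≤H-dot⇔≤ m n = ≤H-⇔-resp-≡ (dot≡tower m) (dot≡tower n) (tower-≤H-tower⇔≤ tt (λ ()) (λ ()) m n)

ddot-≤H-ddot⇔≤ : ∀ m n → (ddot m ≤H ddot n) ⇔ (m ≤ n)
ddot-≤H-ddot⇔≤ m n = ≤H-⇔-resp-≡ (ddot≡tower m) (ddot≡tower n) (tower-≤H-tower⇔≤ tt (λ ()) (λ ()) m n)

dot-≤H-ddot⇔≤ : ∀ m n → (dot m ≤H ddot n) ⇔ (m ≤ n)
dot-≤H-ddot⇔≤ m n = ≤H-⇔-resp-≡ (dot≡tower m) (ddot≡tower n) (tower-≤H-tower⇔≤ tt (λ ()) (λ ()) m n)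

ddot-≰H-dot : ∀ m n → ¬ ddot m ≤H dot n
ddot-≰H-dot m n (_ , 𝟙≤ṅ , _) =
  atom-≰H-tower (λ ()) (λ ()) n (subst (atom 𝟙 ≤H_) (dot≡tower n) 𝟙≤ṅ)

proposition2p5 : ((m n : ℕ) → ((dot m ≤H dot n) ⇔ (ddot m ≤H ddot n)) × ((ddot m ≤H ddot n) ⇔ (dot m ≤H ddot n)) × ((dot m ≤H ddot n) ⇔ (m ≤ n))) × ((m n : ℕ) → ¬ (ddot m ≤H dot n))
proposition2p5 =
  (λ m n → ⇔-trans (dot-≤H-dot⇔≤ m n) (⇔-sym (ddot-≤H-ddot⇔≤ m n)) ,
           ⇔-trans (ddot-≤H-ddot⇔≤ m n) (⇔-sym (dot-≤H-ddot⇔≤ m n)) ,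
           dot-≤H-ddot⇔≤ m n) ,
  ddot-≰H-dot
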